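{- Let $r\ge 1$ and let $F^{[r]}_n=F^{[r]}_n(x_1,\dots,x_r)$ be the $r$-Fibonacci polynomials. For every integer $n\ge 2r-2$, let $A_n$ be the $r\times r$ matrix with entries $(A_n)_{i,j}=F^{[r]}_{n-r+1+j-i}$ for $1\le i,j\le r$ (so its first row is $(F^{[r]}_{n-r+1},\dots,F^{[r]}_n)$ and its last row is $(F^{[r]}_{n-2r+2},\dots,F^{[r]}_{n-r+1})$). Then $$\det A_n=(-1)^{n(r+1)}x_r^{\,n-2r+2}.$$
   Context: For an integer $r\ge 1$, the $r$-Fibonacci polynomial $F^{[r]}_n(x_1,\dots,x_r)$ is defined by $F^{[r]}_n=0$ for $0\le n<r-1$, $F^{[r]}_{r-1}=1$, and $F^{[r]}_n=\sum_{i=1}^r x_iF^{[r]}_{n-i}$ for $n\ge r$. -}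

module Defs where

open import Level using (Level)
open import Data.Nat using (ℕ; zero; suc)
open import Data.Fin using (Fin; zero; suc; punchIn; toℕ)
open import Data.Vec using (Vec; []; _∷_; replicate; init; last)
open import Algebra.Bundles using (CommutativeRing)

module _ {c ℓ : Level} (R : CommutativeRing c ℓ) where
  open CommutativeRing R using (Carrier; _+_; _*_; -_; 0#; 1#)

  pow : Carrier → ℕ → Carrier
  pow a zero    = 1#
  pow a (suc m) = a * pow a m

  Σ : ∀ {m} → (Fin m → Carrier) → Carrier
  Σ {zero}  f = 0#
  Σ {suc m} f = f zero + Σ (λ i → f (suc i))

  det : ∀ m → (Fin m → Fin m → Carrier) → Carrier
  det zero    M = 1#
  det (suc m) M =
    Σ (λ j → pow (- 1#) (toℕ j) * (M zero j * det m (λ a b → M (suc a) (punchIn j b))))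

  -- r-Fibonacci polynomials evaluated at x = (x_1,…,x_r), with r = suc k.
  -- x i (i : Fin (suc k), 0-based) stands for x_{i+1}.
  -- window n = (F_{n+k}, F_{n+k-1}, …, F_n)  (the last r values, most recent first).
  -- window 0 = (F_k, …, F_0) = (1, 0, …, 0);
  -- window (n+1) = (F_{n+r}, F_{n+k}, …, F_{n+1}) where
  --   F_{n+r} = Σ_{i=1}^r x_i F_{n+r-i}.
  dot : ∀ {m} → (Fin m → Carrier) → Vec Carrier m → Carrier
  dot x []       = 0#
  dot x (v ∷ vs) = x zero * v + dot (λ i → x (suc i)) vs

  window : (k : ℕ) → (Fin (suc k) → Carrier) → ℕ → Vec Carrier (suc k)
  window k x zero    = 1# ∷ replicate k 0#
  window k x (suc n) = let w = window k x n in dot x w ∷ init w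

  Fib : (k : ℕ) → (Fin (suc k) → Carrier) → ℕ → Carrier
  Fib k x n = last (window k x n)

-- Write n = 2k + m (so r = k + 1) and T_m for the matrix with entries F_{m+k+j-i}, which is A_n.
-- T_0 is unitriangular because F_0 = ... = F_{k-1} = 0 and F_k = 1.  By the recurrence, the top row
-- of T_{m+1} is the combination sum_l x_{l+1} (row l of T_m), and its other rows are the first k rows
-- of T_m.  Expanding linearly in the top row, every term but the last has a repeated row, and the
-- last is T_m with its bottom row moved to the top, giving det T_{m+1} = x_r (-1)^k det T_m.  Hence
-- det A_n = ((-1)^k x_r)^m, and (-1)^(km) = (-1)^(n(r+1)) since n(k+2) - km is even.
-- Since det is given by Laplace expansion along the first row, being alternating is not free: the
-- expansion along the first two rows is antisymmetric in them, by induction on the size.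

module Submission where

open import Defs
open import Level using (Level)
open import Algebra.Bundles using (CommutativeRing)
open import Data.Nat as ℕ using (ℕ; zero; suc; s≤s; z≤n)
import Data.Nat.Properties as ℕ
open import Data.Nat.Tactic.RingSolver using (solve-∀)
open import Data.Fin using (Fin; zero; suc; toℕ; fromℕ; fromℕ<; inject₁; lower₁; punchIn)
import Data.Fin.Properties as Fin
open import Data.Vec as Vec using (Vec; lookup)
open import Data.Vec.Properties using (lookup-replicate)
open import Data.Vec.Functional using (Vector; _∷_; tail; init; last; removeAt)
open import Function using (_∘_)
open import Relation.Binary.PropositionalEquality as ≡ using (_≡_; _≢_; _≗_; cong)

lookup-init : ∀ {a} {A : Set a} {n} (v : Vec A (suc n)) (i : Fin n) →
              lookup (Vec.init v) i ≡ lookup v (inject₁ i)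
lookup-init {n = suc n} (y Vec.∷ v) zero    = ≡.refl
lookup-init {n = suc n} (y Vec.∷ v) (suc i) = lookup-init v i

last≡lookup-fromℕ : ∀ {a} {A : Set a} {n} (v : Vec A (suc n)) → Vec.last v ≡ lookup v (fromℕ n)
last≡lookup-fromℕ {n = zero}  (y Vec.∷ Vec.[]) = ≡.refl
last≡lookup-fromℕ {n = suc n} (y Vec.∷ v)      = last≡lookup-fromℕ v

module Determinant {c ℓ : Level} (R : CommutativeRing c ℓ) where

  open CommutativeRing R hiding (zero)
  open import Algebra.Properties.Ring ring using (-1*x≈-x; x[y-z]≈xy-xz)
  open import Algebra.Properties.AbelianGroup +-abelianGroup using (⁻¹-anti-homo‿-; ⁻¹-∙-comm)
  open import Algebra.Properties.Group +-group using (ε⁻¹≈ε; ⁻¹-involutive)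
  open import Algebra.Properties.CommutativeSemigroup *-commutativeSemigroup using (x∙yz≈y∙xz)
  open import Algebra.Properties.Semiring.Sum semiring
    using (sum; sum-cong-≋; sum-replicate-zero; ∑-distrib-+; ∑-comm; sum-init-last; *-distribˡ-sum; *-distribʳ-sum)
  open import Algebra.Properties.Semiring.Exp semiring using (_^_)
  open import Relation.Binary.Reasoning.Setoid setoid

  Row : ℕ → Set c
  Row = Vector Carrier

  Matrix : ℕ → ℕ → Set c
  Matrix m n = Vector (Row n) m

  Σ≡sum : ∀ {n} (f : Row n) → Σ R f ≡ sum f
  Σ≡sum {zero}  f = ≡.refl
  Σ≡sum {suc n} f = cong (f zero +_) (Σ≡sum (tail f))

  sum-zero : ∀ {n} {f : Row n} → (∀ i → f i ≈ 0#) → sum f ≈ 0#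
  sum-zero {n} f≈0 = trans (sum-cong-≋ f≈0) (sum-replicate-zero n)

  sum-neg : ∀ {n} (f : Row n) → sum (λ i → - f i) ≈ - sum f
  sum-neg {zero}  f = sym ε⁻¹≈ε
  sum-neg {suc n} f = trans (+-congˡ (sum-neg (tail f))) (⁻¹-∙-comm _ _)

  x*[y*z]≈0 : ∀ x y {z} → z ≈ 0# → x * (y * z) ≈ 0#
  x*[y*z]≈0 x y z≈0 = trans (*-congˡ (trans (*-congˡ z≈0) (zeroʳ y))) (zeroʳ x)

  sign : ∀ {n} → Fin n → Carrier
  sign j = pow R (- 1#) (toℕ j)

  sign-suc : ∀ {n} (j : Fin n) x → sign (suc j) * x ≈ - (sign j * x)
  sign-suc j x = trans (*-assoc _ _ _) (-1*x≈-x _)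

  minor : ∀ {m} → Fin (suc m) → Matrix (suc m) (suc m) → Matrix m m
  minor j M a = removeAt (M (suc a)) j

  laplaceTerm : ∀ {m} → Matrix (suc m) (suc m) → Row (suc m)
  laplaceTerm {m} M j = sign j * (M zero j * det R m (minor j M))

  det-laplace : ∀ {m} (M : Matrix (suc m) (suc m)) → det R (suc m) M ≈ sum (laplaceTerm M)
  det-laplace M = reflexive (Σ≡sum (laplaceTerm M))

  det-cong : ∀ {m} {M N : Matrix m m} → (∀ i j → M i j ≈ N i j) → det R m M ≈ det R m N
  det-cong {zero}          M≈N = refl
  det-cong {suc m} {M} {N} M≈N = begin
    det R (suc m) M
      ≈⟨ det-laplace M ⟩
    sum (laplaceTerm M)
      ≈⟨ sum-cong-≋ {x = laplaceTerm M} {y = laplaceTerm N}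
                    (λ j → *-congˡ (*-cong (M≈N zero j) (det-cong (λ a b → M≈N (suc a) (punchIn j b))))) ⟩
    sum (laplaceTerm N)
      ≈⟨ det-laplace N ⟨
    det R (suc m) N ∎

  det-linearˡ : ∀ {m n} (a : Row n) (V : Matrix n (suc m)) (N : Matrix m (suc m)) →
                det R (suc m) ((λ j → sum (λ l → a l * V l j)) ∷ N) ≈
                sum (λ l → a l * det R (suc m) (V l ∷ N))
  det-linearˡ {m} a V N = begin
    det R (suc m) ((λ j → sum (λ l → a l * V l j)) ∷ N)
      ≈⟨ det-laplace ((λ j → sum (λ l → a l * V l j)) ∷ N) ⟩
    sum (λ j → sign j * (sum (λ l → a l * V l j) * μ j))
      ≈⟨ sum-cong-≋ {y = λ j → sum (λ l → a l * (sign j * (V l j * μ j)))} distribute ⟩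
    sum (λ j → sum (λ l → a l * (sign j * (V l j * μ j))))
      ≈⟨ ∑-comm (λ j l → a l * (sign j * (V l j * μ j))) ⟩
    sum (λ l → sum (λ j → a l * (sign j * (V l j * μ j))))
      ≈⟨ sum-cong-≋ (λ l → *-distribˡ-sum (a l) (λ j → sign j * (V l j * μ j))) ⟨
    sum (λ l → a l * sum (λ j → sign j * (V l j * μ j)))
      ≈⟨ sum-cong-≋ (λ l → *-congˡ (det-laplace (V l ∷ N))) ⟨
    sum (λ l → a l * det R (suc m) (V l ∷ N)) ∎
    where
    μ : Row (suc m)
    μ j = det R m (λ r → removeAt (N r) j)
    distribute : ∀ j → sign j * (sum (λ l → a l * V l j) * μ j) ≈ sum (λ l → a l * (sign j * (V l j * μ j)))
    distribute j = begin
      sign j * (sum (λ l → a l * V l j) * μ j)  ≈⟨ *-congˡ (*-distribʳ-sum (μ j) (λ l → a l * V l j)) ⟩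
      sign j * sum (λ l → a l * V l j * μ j)    ≈⟨ *-distribˡ-sum (sign j) (λ l → a l * V l j * μ j) ⟩
      sum (λ l → sign j * (a l * V l j * μ j))  ≈⟨ sum-cong-≋ (λ l → trans (*-congˡ (*-assoc (a l) (V l j) (μ j))) (x∙yz≈y∙xz (sign j) (a l) (V l j * μ j))) ⟩
      sum (λ l → a l * (sign j * (V l j * μ j))) ∎

  det-scaledMinors : ∀ {m} (a : Carrier) {M N : Matrix (suc m) (suc m)} →
                     (∀ j → M zero j ≈ N zero j) →
                     (∀ j → det R m (minor j M) ≈ a * det R m (minor j N)) →
                     det R (suc m) M ≈ a * det R (suc m) N
  det-scaledMinors {m} a {M} {N} row minors = begin
    det R (suc m) M
      ≈⟨ det-laplace M ⟩
    sum (laplaceTerm M)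
      ≈⟨ sum-cong-≋ {x = laplaceTerm M} {y = λ j → a * laplaceTerm N j} scale ⟩
    sum (λ j → a * laplaceTerm N j)
      ≈⟨ *-distribˡ-sum a (laplaceTerm N) ⟨
    a * sum (laplaceTerm N)
      ≈⟨ *-congˡ (det-laplace N) ⟨
    a * det R (suc m) N ∎
    where
    scale : ∀ j → laplaceTerm M j ≈ a * laplaceTerm N j
    scale j = trans (*-congˡ (trans (*-cong (row j) (minors j)) (x∙yz≈y∙xz (N zero j) a _))) (x∙yz≈y∙xz (sign j) a _)

  -- Laplace expansion along the first two rows; Ψ f stands for the determinant of the remaining
  -- rows restricted to the columns f left over by the first two.
  Respects≗ : ∀ {p q} → ((Fin p → Fin q) → Carrier) → Set ℓ
  Respects≗ Ψ = ∀ {f g} → f ≗ g → Ψ f ≈ Ψ g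

  pairExpansion : ∀ {p} → Row (suc (suc p)) → Row (suc (suc p)) → ((Fin p → Fin (suc (suc p))) → Carrier) → Carrier
  pairExpansion u v Ψ =
    sum (λ j → sign j * (u j * sum (λ l → sign l * (v (punchIn j l) * Ψ (punchIn j ∘ punchIn l)))))

  rowExpansion : ∀ {p} → Row (suc p) → ((Fin p → Fin (suc (suc p))) → Carrier) → Carrier
  rowExpansion u Ψ = sum (λ j → sign j * (u j * Ψ (suc ∘ punchIn j)))

  keepColumn₀ : ∀ {p q} → (Fin p → Fin q) → Fin (suc p) → Fin (suc q)
  keepColumn₀ f = zero ∷ (suc ∘ f)

  keepColumn₀-respects : ∀ {p q} {Ψ : (Fin (suc p) → Fin (suc q)) → Carrier} →
                         Respects≗ Ψ → Respects≗ (Ψ ∘ keepColumn₀)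
  keepColumn₀-respects resp f≗g = resp λ where
    zero    → ≡.refl
    (suc c) → cong suc (f≗g c)

  pairExpansion-zero : ∀ (u v : Row 2) Ψ → Respects≗ Ψ →
                       pairExpansion u v Ψ ≈ u zero * (v (suc zero) * Ψ (λ ())) - u (suc zero) * (v zero * Ψ (λ ()))
  pairExpansion-zero u v Ψ resp =
    +-cong (trans (*-identityˡ _) (*-congˡ (single (v (suc zero)) _)))
           (trans (+-identityʳ _) (trans (sign-suc {1} zero _) (-‿cong (trans (*-identityˡ _) (*-congˡ (single (v zero) _))))))
    where
    single : ∀ w f → 1# * (w * Ψ f) + 0# ≈ w * Ψ (λ ())
    single w f = trans (+-identityʳ _) (trans (*-identityˡ _) (*-congˡ (resp (λ ()))))

  pairExpansion-suc : ∀ {q} (u v : Row (suc (suc (suc q)))) Ψ → Respects≗ Ψ →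
                      pairExpansion u v Ψ ≈
                      (u zero * rowExpansion (tail v) Ψ - v zero * rowExpansion (tail u) Ψ)
                        + pairExpansion (tail u) (tail v) (Ψ ∘ keepColumn₀)
  pairExpansion-suc {q} u v Ψ resp = begin
    1# * (u zero * rowExpansion (tail v) Ψ) + sum (λ j → sign (suc j) * (u (suc j) * inner j))
      ≈⟨ +-cong (*-identityˡ _) (sum-cong-≋ term) ⟩
    u zero * rowExpansion (tail v) Ψ + sum (λ j → - (v zero * W j) + V j)
      ≈⟨ +-congˡ (∑-distrib-+ (λ j → - (v zero * W j)) V) ⟩
    u zero * rowExpansion (tail v) Ψ + (sum (λ j → - (v zero * W j)) + sum V)
      ≈⟨ +-congˡ (+-congʳ (trans (sum-neg (λ j → v zero * W j)) (-‿cong (sym (*-distribˡ-sum (v zero) W))))) ⟩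
    u zero * rowExpansion (tail v) Ψ + (- (v zero * rowExpansion (tail u) Ψ) + sum V)
      ≈⟨ +-assoc _ _ _ ⟨
    (u zero * rowExpansion (tail v) Ψ - v zero * rowExpansion (tail u) Ψ) + sum V ∎
    where
    inner : Fin (suc (suc q)) → Carrier
    inner j = sum (λ l → sign l * (v (punchIn (suc j) l) * Ψ (punchIn (suc j) ∘ punchIn l)))
    Zterm : Fin (suc (suc q)) → Fin (suc q) → Carrier
    Zterm j l = sign l * (v (suc (punchIn j l)) * Ψ (keepColumn₀ (punchIn j ∘ punchIn l)))
    P W Z V : Fin (suc (suc q)) → Carrier
    P j = Ψ (suc ∘ punchIn j)
    W j = sign j * (u (suc j) * P j)
    Z j = sum (Zterm j)
    V j = sign j * (u (suc j) * Z j)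
    -- column 0 is either taken by the second row (l = 0) or left to the remaining rows
    inner≈ : ∀ j → inner j ≈ v zero * P j - Z j
    inner≈ j = +-cong (*-identityˡ (v zero * P j)) (begin
      sum (λ l → sign (suc l) * (v (suc (punchIn j l)) * Ψ (punchIn (suc j) ∘ punchIn (suc l))))
        ≈⟨ sum-cong-≋ (λ l → trans (sign-suc l (v (suc (punchIn j l)) * Ψ (punchIn (suc j) ∘ punchIn (suc l)))) (-‿cong (*-congˡ (*-congˡ (resp (keep l)))))) ⟩
      sum (λ l → - Zterm j l)
        ≈⟨ sum-neg (Zterm j) ⟩
      - Z j ∎)
      where
      keep : ∀ l → punchIn (suc j) ∘ punchIn (suc l) ≗ keepColumn₀ (punchIn j ∘ punchIn l)
      keep l zero    = ≡.refl
      keep l (suc c) = ≡.refl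
    term : ∀ j → sign (suc j) * (u (suc j) * inner j) ≈ - (v zero * W j) + V j
    term j = begin
      sign (suc j) * (u (suc j) * inner j)
        ≈⟨ trans (sign-suc j _) (-‿cong (*-congˡ (*-congˡ (inner≈ j)))) ⟩
      - (sign j * (u (suc j) * (v zero * P j - Z j)))
        ≈⟨ -‿cong (trans (*-congˡ (x[y-z]≈xy-xz _ _ _)) (x[y-z]≈xy-xz _ _ _)) ⟩
      - (sign j * (u (suc j) * (v zero * P j)) - V j)
        ≈⟨ ⁻¹-∙-comm _ _ ⟨
      - (sign j * (u (suc j) * (v zero * P j))) + - - V j
        ≈⟨ +-cong (-‿cong (trans (*-congˡ (x∙yz≈y∙xz _ _ _)) (x∙yz≈y∙xz _ _ _))) (⁻¹-involutive _) ⟩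
      - (v zero * W j) + V j ∎

  pairExpansion-antisym : ∀ p (u v : Row (suc (suc p))) Ψ → Respects≗ Ψ →
                          pairExpansion u v Ψ ≈ - pairExpansion v u Ψ
  pairExpansion-antisym zero u v Ψ resp = begin
    pairExpansion u v Ψ
      ≈⟨ pairExpansion-zero u v Ψ resp ⟩
    u zero * (v (suc zero) * Q) - u (suc zero) * (v zero * Q)
      ≈⟨ +-cong (x∙yz≈y∙xz _ _ _) (-‿cong (x∙yz≈y∙xz _ _ _)) ⟩
    v (suc zero) * (u zero * Q) - v zero * (u (suc zero) * Q)
      ≈⟨ ⁻¹-anti-homo‿- _ _ ⟨
    - (v zero * (u (suc zero) * Q) - v (suc zero) * (u zero * Q))
      ≈⟨ -‿cong (pairExpansion-zero v u Ψ resp) ⟨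
    - pairExpansion v u Ψ ∎
    where
    Q : Carrier
    Q = Ψ (λ ())
  pairExpansion-antisym (suc q) u v Ψ resp = begin
    pairExpansion u v Ψ
      ≈⟨ pairExpansion-suc u v Ψ resp ⟩
    (A - B) + pairExpansion (tail u) (tail v) Ψ′
      ≈⟨ +-cong (⁻¹-anti-homo‿- B A) (sym (pairExpansion-antisym q (tail u) (tail v) Ψ′ (keepColumn₀-respects resp))) ⟨
    - (B - A) + - pairExpansion (tail v) (tail u) Ψ′
      ≈⟨ ⁻¹-∙-comm _ _ ⟩
    - ((B - A) + pairExpansion (tail v) (tail u) Ψ′)
      ≈⟨ -‿cong (pairExpansion-suc v u Ψ resp) ⟨
    - pairExpansion v u Ψ ∎
    where
    A B : Carrier
    A = u zero * rowExpansion (tail v) Ψ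
    B = v zero * rowExpansion (tail u) Ψ
    Ψ′ : (Fin q → Fin (suc (suc q))) → Carrier
    Ψ′ = Ψ ∘ keepColumn₀

  pairExpansion-alternating : ∀ p (u : Row (suc (suc p))) Ψ → Respects≗ Ψ → pairExpansion u u Ψ ≈ 0#
  pairExpansion-alternating zero u Ψ resp =
    trans (pairExpansion-zero u u Ψ resp) (trans (+-congʳ (x∙yz≈y∙xz _ _ _)) (-‿inverseʳ _))
  pairExpansion-alternating (suc q) u Ψ resp =
    trans (pairExpansion-suc u u Ψ resp)
          (trans (+-cong (-‿inverseʳ _) (pairExpansion-alternating q (tail u) _ (keepColumn₀-respects resp)))
                 (+-identityʳ 0#))

  detColumns : ∀ {p q} → Matrix p q → (Fin p → Fin q) → Carrier
  detColumns {p} N f = det R p (λ r → N r ∘ f)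

  detColumns-respects : ∀ {p q} (N : Matrix p q) → Respects≗ (detColumns N)
  detColumns-respects N f≗g = det-cong (λ r b → reflexive (cong (N r) (f≗g b)))

  det-pairExpansion : ∀ {p} (M : Matrix (suc (suc p)) (suc (suc p))) →
                      det R (suc (suc p)) M ≈ pairExpansion (M zero) (M (suc zero)) (detColumns (tail (tail M)))
  det-pairExpansion {p} M = begin
    det R (suc (suc p)) M
      ≈⟨ det-laplace M ⟩
    sum (laplaceTerm M)
      ≈⟨ sum-cong-≋ {x = laplaceTerm M} (λ j → *-congˡ (*-congˡ (det-laplace (minor j M)))) ⟩
    pairExpansion (M zero) (M (suc zero)) (detColumns (tail (tail M))) ∎

  det-swap : ∀ {p} (M : Matrix (suc (suc p)) (suc (suc p))) →
             det R (suc (suc p)) M ≈ - det R (suc (suc p)) (M (suc zero) ∷ M zero ∷ tail (tail M))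
  det-swap {p} M = begin
    det R (suc (suc p)) M
      ≈⟨ det-pairExpansion M ⟩
    pairExpansion (M zero) (M (suc zero)) Ψ
      ≈⟨ pairExpansion-antisym p (M zero) (M (suc zero)) Ψ (detColumns-respects (tail (tail M))) ⟩
    - pairExpansion (M (suc zero)) (M zero) Ψ
      ≈⟨ -‿cong (det-pairExpansion (M (suc zero) ∷ M zero ∷ tail (tail M))) ⟨
    - det R (suc (suc p)) (M (suc zero) ∷ M zero ∷ tail (tail M)) ∎
    where
    Ψ : (Fin p → Fin (suc (suc p))) → Carrier
    Ψ = detColumns (tail (tail M))

  det-duplicateRow : ∀ {m} (N : Matrix m (suc m)) (l : Fin m) → det R (suc m) (N l ∷ N) ≈ 0#
  det-duplicateRow N zero =
    trans (det-pairExpansion (N zero ∷ N))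
          (pairExpansion-alternating _ (N zero) _ (detColumns-respects (tail N)))
  det-duplicateRow {suc m} N (suc l) = begin
    det R (suc (suc m)) (N (suc l) ∷ N)
      ≈⟨ det-swap (N (suc l) ∷ N) ⟩
    - det R (suc (suc m)) (N zero ∷ N (suc l) ∷ tail N)
      ≈⟨ -‿cong (det-scaledMinors 0# {M′} {M′} (λ _ → refl) minors) ⟩
    - (0# * det R (suc (suc m)) (N zero ∷ N (suc l) ∷ tail N))
      ≈⟨ -‿cong (zeroˡ _) ⟩
    - 0#
      ≈⟨ ε⁻¹≈ε ⟩
    0# ∎
    where
    M′ : Matrix (suc (suc m)) (suc (suc m))
    M′ = N zero ∷ N (suc l) ∷ tail N
    minors : ∀ j → det R (suc m) (minor j M′) ≈ 0# * det R (suc m) (minor j M′)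
    minors j = trans (det-duplicateRow (λ a → removeAt (N (suc a)) j) l) (sym (zeroˡ _))

  det-last∷init : ∀ {m} (M : Matrix (suc m) (suc m)) →
                  det R (suc m) (last M ∷ init M) ≈ (- 1#) ^ m * det R (suc m) M
  det-last∷init {zero}  M = sym (*-identityˡ _)
  det-last∷init {suc m} M = begin
    det R (suc (suc m)) (last M ∷ init M)
      ≈⟨ det-swap (last M ∷ init M) ⟩
    - det R (suc (suc m)) (M zero ∷ last M ∷ tail (init M))
      ≈⟨ -‿cong (det-scaledMinors ((- 1#) ^ m) {M zero ∷ last M ∷ tail (init M)} {M} (λ _ → refl) (λ j → det-last∷init (minor j M))) ⟩
    - ((- 1#) ^ m * det R (suc (suc m)) M)
      ≈⟨ trans (*-assoc _ _ _) (-1*x≈-x _) ⟨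
    (- 1#) ^ suc m * det R (suc (suc m)) M ∎

  -- Every term of the top row but the last repeats a row of init M.
  det-∑∷init : ∀ {m} (a : Row (suc m)) (M : Matrix (suc m) (suc m)) →
               det R (suc m) ((λ j → sum (λ l → a l * M l j)) ∷ init M) ≈
               a (fromℕ m) * ((- 1#) ^ m * det R (suc m) M)
  det-∑∷init {m} a M = begin
    det R (suc m) ((λ j → sum (λ l → a l * M l j)) ∷ init M)
      ≈⟨ det-linearˡ a M (init M) ⟩
    sum (λ l → a l * det R (suc m) (M l ∷ init M))
      ≈⟨ sum-init-last (λ l → a l * det R (suc m) (M l ∷ init M)) ⟩
    sum (λ l → a (inject₁ l) * det R (suc m) (init M l ∷ init M)) + a (fromℕ m) * det R (suc m) (last M ∷ init M)
      ≈⟨ +-cong (sum-zero (λ l → trans (*-congˡ (det-duplicateRow (init M) l)) (zeroʳ _)))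
                (*-congˡ (det-last∷init M)) ⟩
    0# + a (fromℕ m) * ((- 1#) ^ m * det R (suc m) M)
      ≈⟨ +-identityˡ _ ⟩
    a (fromℕ m) * ((- 1#) ^ m * det R (suc m) M) ∎

  det-zeroColumn : ∀ {m} (M : Matrix (suc m) (suc m)) → (∀ i → M i zero ≈ 0#) → det R (suc m) M ≈ 0#
  det-minor-zeroColumn : ∀ {m} (M : Matrix (suc m) (suc m)) → (∀ i → M (suc i) zero ≈ 0#) →
                         (j : Fin m) → det R m (minor (suc j) M) ≈ 0#

  det-zeroColumn {m} M col = trans (det-laplace M) (sum-zero {f = laplaceTerm M} λ where
    zero    → trans (*-congˡ (trans (*-congʳ (col zero)) (zeroˡ _))) (zeroʳ _)
    (suc j) → x*[y*z]≈0 _ _ (det-minor-zeroColumn M (col ∘ suc) j))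

  det-minor-zeroColumn {suc m} M col j = det-zeroColumn (minor (suc j) M) col

  det-unitriangular : ∀ m (M : Matrix m m) → (∀ i j → toℕ j ℕ.< toℕ i → M i j ≈ 0#) → (∀ i → M i i ≈ 1#) →
                      det R m M ≈ 1#
  det-unitriangular zero    M lower diag = refl
  det-unitriangular (suc m) M lower diag =
    trans (det-laplace M) (trans (+-cong leading (sum-zero offDiagonal)) (+-identityʳ 1#))
    where
    leading : sign {suc m} zero * (M zero zero * det R m (minor zero M)) ≈ 1#
    leading = trans (*-identityˡ _) (trans (*-cong (diag zero) minor-unitriangular) (*-identityˡ 1#))
      where
      minor-unitriangular : det R m (minor zero M) ≈ 1#
      minor-unitriangular = det-unitriangular m (minor zero M) (λ i j j<i → lower (suc i) (suc j) (s≤s j<i)) (diag ∘ suc)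
    offDiagonal : ∀ j → sign (suc j) * (M zero (suc j) * det R m (minor (suc j) M)) ≈ 0#
    offDiagonal j = x*[y*z]≈0 _ _ (det-minor-zeroColumn M (λ i → lower (suc i) zero (s≤s z≤n)) j)

module Powers {c ℓ : Level} (R : CommutativeRing c ℓ) where

  open CommutativeRing R
  open import Algebra.Properties.Ring ring using (-1*x≈-x)
  open import Algebra.Properties.Group +-group using (⁻¹-involutive)
  open import Algebra.Properties.Semiring.Exp semiring public using (_^_; ^-congʳ)
  open import Algebra.Properties.Semiring.Exp semiring using (^-congˡ; ^-homo-*; ^-assocʳ)
  open import Algebra.Properties.CommutativeSemiring.Exp commutativeSemiring using (^-distrib-*)

  pow≡^ : ∀ a n → pow R a n ≡ a ^ n
  pow≡^ a zero    = ≡.refl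
  pow≡^ a (suc n) = cong (a *_) (pow≡^ a n)

  1^n≈1 : ∀ n → 1# ^ n ≈ 1#
  1^n≈1 zero    = refl
  1^n≈1 (suc n) = trans (*-identityˡ _) (1^n≈1 n)

  -1^[e+2t]≈-1^e : ∀ e t → (- 1#) ^ (e ℕ.+ 2 ℕ.* t) ≈ (- 1#) ^ e
  -1^[e+2t]≈-1^e e t = trans (^-homo-* (- 1#) e (2 ℕ.* t)) (trans (*-congˡ -1^[2t]≈1) (*-identityʳ _))
    where
    -1^2≈1 : (- 1#) ^ 2 ≈ 1#
    -1^2≈1 = trans (*-congˡ (*-identityʳ _)) (trans (-1*x≈-x _) (⁻¹-involutive 1#))
    -1^[2t]≈1 : (- 1#) ^ (2 ℕ.* t) ≈ 1#
    -1^[2t]≈1 = trans (sym (^-assocʳ (- 1#) 2 t)) (trans (^-congˡ t -1^2≈1) (1^n≈1 t))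

  [-1^k*a]^m≈-1^[k*m]*a^m : ∀ k m a → ((- 1#) ^ k * a) ^ m ≈ (- 1#) ^ (k ℕ.* m) * a ^ m
  [-1^k*a]^m≈-1^[k*m]*a^m k m a = trans (^-distrib-* _ a m) (*-congʳ (^-assocʳ (- 1#) k m))

module Fibonacci {c ℓ : Level} (R : CommutativeRing c ℓ) (k : ℕ) (x : Fin (suc k) → CommutativeRing.Carrier R) where

  open CommutativeRing R using (Carrier; _≈_; _*_; 0#; 1#; -_; refl; trans; reflexive; +-congˡ; *-congˡ; semiring)
  open import Algebra.Properties.CommutativeSemigroup (CommutativeRing.*-commutativeSemigroup R) using (x∙yz≈yx∙z)
  open import Algebra.Properties.Semiring.Sum semiring using (sum; sum-cong-≋)
  open Determinant R using (Row; Matrix; det-cong; det-∑∷init; det-unitriangular)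
  open Powers R using (_^_)
  open import Data.Nat using (_+_; _∸_; _<_; _≤_)

  F : ℕ → Carrier
  F = Fib R k x

  W : ℕ → Vec Carrier (suc k)
  W = window R k x

  lookup-window : ∀ e (i : Fin (suc k)) d → toℕ i + e ≡ k → lookup (W d) i ≡ F (d + e)
  lookup-window zero i d i≡k = begin
    lookup (W d) i          ≡⟨ cong (lookup (W d)) i≡fromℕk ⟩
    lookup (W d) (fromℕ k)  ≡⟨ last≡lookup-fromℕ (W d) ⟨
    F d                     ≡⟨ cong F (ℕ.+-identityʳ d) ⟨
    F (d + 0)               ∎
    where
    open ≡.≡-Reasoning
    i≡fromℕk : i ≡ fromℕ k
    i≡fromℕk = Fin.toℕ-injective (≡.trans (≡.trans (≡.sym (ℕ.+-identityʳ _)) i≡k) (≡.sym (Fin.toℕ-fromℕ k)))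
  lookup-window (suc e) i d i+e≡k = begin
    lookup (W d) i                    ≡⟨ cong (lookup (W d)) (Fin.inject₁-lower₁ i k≢i) ⟨
    lookup (W d) (inject₁ i′)         ≡⟨ lookup-init (W d) i′ ⟨
    lookup (W (suc d)) (suc i′)       ≡⟨ lookup-window e (suc i′) (suc d) i′+e≡k ⟩
    F (suc d + e)                     ≡⟨ cong F (ℕ.+-suc d e) ⟨
    F (d + suc e)                     ∎
    where
    open ≡.≡-Reasoning
    k≢i : k ≢ toℕ i
    k≢i k≡i = ℕ.m≢1+m+n (toℕ i) (≡.trans (≡.sym k≡i) (≡.trans (≡.sym i+e≡k) (ℕ.+-suc (toℕ i) e)))
    i′ : Fin k
    i′ = lower₁ i k≢i
    i′+e≡k : suc (toℕ i′) + e ≡ k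
    i′+e≡k = ≡.trans (cong (λ t → suc t + e) (Fin.toℕ-lower₁ i k≢i)) (≡.trans (≡.sym (ℕ.+-suc (toℕ i) e)) i+e≡k)

  Fib-k : F k ≡ 1#
  Fib-k = ≡.sym (lookup-window k zero 0 ≡.refl)

  Fib-< : ∀ t → t < k → F t ≡ 0#
  Fib-< t t<k = ≡.trans (≡.sym (lookup-window t i 0 i+t≡k)) (initial i 0<i)
    where
    i : Fin (suc k)
    i = fromℕ< (s≤s (ℕ.m∸n≤m k t))
    toℕi : toℕ i ≡ k ∸ t
    toℕi = Fin.toℕ-fromℕ< (s≤s (ℕ.m∸n≤m k t))
    i+t≡k : toℕ i + t ≡ k
    i+t≡k = ≡.trans (cong (_+ t) toℕi) (ℕ.m∸n+n≡m (ℕ.<⇒≤ t<k))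
    0<i : 0 < toℕ i
    0<i = ≡.subst (0 <_) (≡.sym toℕi) (ℕ.m<n⇒0<n∸m t<k)
    initial : ∀ (j : Fin (suc k)) → 0 < toℕ j → lookup (W 0) j ≡ 0#
    initial (suc j) _ = lookup-replicate j 0#

  dot-sum : ∀ {m} (y : Row m) (v : Vec Carrier m) → dot R y v ≈ sum (λ l → y l * lookup v l)
  dot-sum y Vec.[]       = refl
  dot-sum y (a Vec.∷ v) = +-congˡ (dot-sum (tail y) v)

  Fib-rec : ∀ n → k ≤ n → F (suc n) ≈ sum (λ l → x l * F (n ∸ toℕ l))
  Fib-rec n k≤n = ≡.subst (λ n → F (suc n) ≈ sum (λ l → x l * F (n ∸ toℕ l))) (ℕ.m∸n+n≡m k≤n) (rec (n ∸ k))
    where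
    rec : ∀ d → F (suc (d + k)) ≈ sum (λ l → x l * F ((d + k) ∸ toℕ l))
    rec d = trans (reflexive (≡.sym (lookup-window k zero (suc d) ≡.refl)))
                  (trans (dot-sum x (W d)) (sum-cong-≋ (λ l → reflexive (cong (x l *_) (entry l)))))
      where
      entry : ∀ l → lookup (W d) l ≡ F ((d + k) ∸ toℕ l)
      entry l = ≡.trans (lookup-window (k ∸ toℕ l) l d (ℕ.m+[n∸m]≡n l≤k)) (cong F (≡.sym (ℕ.+-∸-assoc d l≤k)))
        where
        l≤k : toℕ l ≤ k
        l≤k = Fin.toℕ≤pred[n] l

  -- fibMatrix (n - 2k) is the matrix A_n of the statement.
  fibMatrix : ℕ → Matrix (suc k) (suc k)
  fibMatrix m i j = F ((m + k + toℕ j) ∸ toℕ i)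

  fibMatrix-suc : ∀ m i j → fibMatrix (suc m) i j ≈ ((λ j → sum (λ l → x l * fibMatrix m l j)) ∷ init (fibMatrix m)) i j
  fibMatrix-suc m zero    j = Fib-rec (m + k + toℕ j) (ℕ.≤-trans (ℕ.m≤n+m k m) (ℕ.m≤m+n (m + k) (toℕ j)))
  fibMatrix-suc m (suc a) j = reflexive (cong (λ t → F ((m + k + toℕ j) ∸ t)) (≡.sym (Fin.toℕ-inject₁ a)))

  fibMatrix-zero-lower : ∀ i j → toℕ j < toℕ i → fibMatrix 0 i j ≈ 0#
  fibMatrix-zero-lower i j j<i = reflexive (Fib-< _ (≡.subst ((k + toℕ j) ∸ toℕ i <_) (ℕ.m+n∸n≡m k (toℕ i))
    (ℕ.∸-monoˡ-< (ℕ.+-monoʳ-< k j<i) (ℕ.≤-trans (Fin.toℕ≤pred[n] i) (ℕ.m≤m+n k (toℕ j))))))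

  fibMatrix-zero-diagonal : ∀ i → fibMatrix 0 i i ≈ 1#
  fibMatrix-zero-diagonal i = reflexive (≡.trans (cong F (ℕ.m+n∸n≡m k (toℕ i))) Fib-k)

  det-fibMatrix : ∀ m → det R (suc k) (fibMatrix m) ≈ ((- 1#) ^ k * x (fromℕ k)) ^ m
  det-fibMatrix zero    = det-unitriangular (suc k) (fibMatrix 0) fibMatrix-zero-lower fibMatrix-zero-diagonal
  det-fibMatrix (suc m) =
    trans (det-cong (fibMatrix-suc m))
          (trans (det-∑∷init x (fibMatrix m))
                 (trans (*-congˡ (*-congˡ (det-fibMatrix m))) (x∙yz≈yx∙z _ _ _)))

open import Data.Nat using (_+_; _*_; _∸_; _≤_)

theorem2p6 : ∀ {c ℓ : Level} (R : CommutativeRing c ℓ) (k : ℕ)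
    (x : Fin (suc k) → CommutativeRing.Carrier R) (n : ℕ) → 2 * k ≤ n →
    CommutativeRing._≈_ R
      (det R (suc k) (λ i j → Fib R k x ((n ∸ k + toℕ j) ∸ toℕ i)))
      (CommutativeRing._*_ R
        (pow R (CommutativeRing.-_ R (CommutativeRing.1# R)) (n * (suc k + 1)))
        (pow R (x (fromℕ k)) (n ∸ 2 * k)))
theorem2p6 R k x n 2k≤n = begin
  det R (suc k) (λ i j → Fib R k x ((n ∸ k + toℕ j) ∸ toℕ i))
    ≈⟨ det-cong {suc k} (λ i j → reflexive (cong (λ t → Fib R k x ((t + toℕ j) ∸ toℕ i)) n∸k≡m+k)) ⟩
  det R (suc k) (fibMatrix m)
    ≈⟨ det-fibMatrix m ⟩
  ((- 1#) ^ k · x (fromℕ k)) ^ m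
    ≈⟨ [-1^k*a]^m≈-1^[k*m]*a^m k m (x (fromℕ k)) ⟩
  (- 1#) ^ (k * m) · x (fromℕ k) ^ m
    ≈⟨ *-congʳ (trans (^-congʳ (- 1#) exponent) (-1^[e+2t]≈-1^e (k * m) t)) ⟨
  (- 1#) ^ (n * (suc k + 1)) · x (fromℕ k) ^ m
    ≡⟨ ≡.cong₂ _·_ (pow≡^ (- 1#) (n * (suc k + 1))) (pow≡^ (x (fromℕ k)) m) ⟨
  pow R (- 1#) (n * (suc k + 1)) · pow R (x (fromℕ k)) m ∎
  where
  open CommutativeRing R using (setoid; -_; 1#; trans; reflexive; *-congʳ) renaming (_*_ to _·_)
  open import Relation.Binary.Reasoning.Setoid setoid
  open Determinant R using (det-cong)
  open Powers R using (_^_; ^-congʳ; pow≡^; -1^[e+2t]≈-1^e; [-1^k*a]^m≈-1^[k*m]*a^m)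
  open Fibonacci R k x using (fibMatrix; det-fibMatrix)
  m t : ℕ
  m = n ∸ 2 * k
  t = k * k + 2 * k + m
  n≡2k+m : n ≡ 2 * k + m
  n≡2k+m = ≡.sym (ℕ.m+[n∸m]≡n 2k≤n)
  n∸k≡m+k : n ∸ k ≡ m + k
  n∸k≡m+k = ≡.trans (cong (_∸ k) (≡.trans n≡2k+m (rearrange k m))) (ℕ.m+n∸n≡m (m + k) k)
    where
    rearrange : ∀ k m → 2 * k + m ≡ m + k + k
    rearrange = solve-∀
  exponent : n * (suc k + 1) ≡ k * m + 2 * t
  exponent = ≡.trans (cong (_* (suc k + 1)) n≡2k+m) (parity k m)
    where
    parity : ∀ k m → (2 * k + m) * (suc k + 1) ≡ k * m + 2 * (k * k + 2 * k + m)
    parity = solve-∀
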